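{- Let $n,h\ge2$ and $p\in\mathcal{P}$ with $\mu(p^r)\le\mu(p)$. Then: (i) $D_{\mu(p)}(p)\cap D_{\mu(p^r)}(p^r)\subseteq\mathrm{I}(\Gamma_{\mu(p)}(p))$; in particular, if $\Gamma_{\mu(p)}(p)$ is connected, then $D_{\mu(p)}(p)\cap D_{\mu(p^r)}(p^r)=\varnothing$. (ii) If $|D_{\mu(p)}(p)|=1$ and $\Gamma_{\mu(p)}(p)$ is acyclic, then $D_{\mu(p)}(p)\cap D_{\mu(p^r)}(p^r)=\varnothing$.
   Context: $N=\{1,\dots,n\}$, $H=\{1,\dots,h\}$, $\mathcal{P}=\mathcal{L}(N)^h$ the set of profiles of linear orders on $N$; $x>_{p_i}y$ means individual $i$ ranks $x$ above $y$; $p^r$ reverses each individual's order. For integers $\mu$ with $h/2<\mu\le h$: $D_\mu(p)=\{x\in N:\forall y,\ |\{i: y>_{p_i}x\}|<\mu\}$; $\mu(p)=\min\{\mu: D_\mu(p)\ne\varnothing\}$; $\Gamma_\mu(p)$ is the directed graph on $N$ with arcs $(x,y)$ whenever $|\{i:x>_{p_i}y\}|\ge\mu$. $\mathrm{I}$ denotes the set of isolated vertices; connected means the underlying undirected graph is connected; acyclic means no subgraph is an $l$-cycle for any $l\ge2$. -}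

module Defs where

open import Data.Nat using (ℕ; zero; suc; _+_; _*_; _<_; _≤_; _≥_)
open import Data.Fin using (Fin; zero; suc; inject₁; fromℕ; opposite; _<?_)
open import Data.Fin.Properties using (opposite-involutive)
open import Data.List using (length; filter; allFin)
open import Data.Product using (Σ; ∃; ∃-syntax; _×_; _,_)
open import Data.Sum using (_⊎_)
open import Data.Empty using (⊥)
open import Function.Definitions using (Injective)
open import Relation.Nullary using (¬_)
open import Relation.Binary.PropositionalEquality using (_≡_; cong; sym; trans)
open import Relation.Binary.Construct.Closure.ReflexiveTransitive using (Star)

-- A linear order on N = Fin n, given by an injective (hence bijective) rank
-- function: rank 0 is the top. x >_o y  iff  rank x < rank y.
LinOrd : ℕ → Set
LinOrd n = Σ (Fin n → Fin n) (Injective _≡_ _≡_)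

rank : ∀ {n} → LinOrd n → Fin n → Fin n
rank (r , _) = r

_≻[_]_ : ∀ {n} → Fin n → LinOrd n → Fin n → Set
x ≻[ o ] y = Data.Fin._<_ (rank o x) (rank o y)

revOrd : ∀ {n} → LinOrd n → LinOrd n
revOrd (r , inj) = (λ x → opposite (r x)) ,
  (λ {x} {y} e → inj (trans (sym (opposite-involutive (r x)))
                      (trans (cong opposite e) (opposite-involutive (r y)))))

Profile : ℕ → ℕ → Set
Profile n h = Fin h → LinOrd n

rev : ∀ {n h} → Profile n h → Profile n h
rev p i = revOrd (p i)

beats : ∀ {n h} → Profile n h → Fin n → Fin n → ℕ
beats {h = h} p x y = length (filter (λ i → rank (p i) x <? rank (p i) y) (allFin h))

Admissible : ℕ → ℕ → Set
Admissible h μ = h < 2 * μ × μ ≤ h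

D : ∀ {n h} → ℕ → Profile n h → Fin n → Set
D μ p x = ∀ y → beats p y x < μ

IsMu : ∀ {n h} → Profile n h → ℕ → Set
IsMu {h = h} p m =
  Admissible h m × (∃[ x ] D m p x) ×
  (∀ μ → Admissible h μ → μ < m → ∀ x → ¬ D μ p x)

Arc : ∀ {n h} → ℕ → Profile n h → Fin n → Fin n → Set
Arc μ p x y = beats p x y ≥ μ

Isolated : ∀ {n h} → ℕ → Profile n h → Fin n → Set
Isolated μ p x = ∀ y → ¬ Arc μ p x y × ¬ Arc μ p y x

Connected : ∀ {n h} → ℕ → Profile n h → Set
Connected μ p = ∀ x y → Star (λ a b → Arc μ p a b ⊎ Arc μ p b a) x y

-- an l-cycle (l = suc k) in Γ_μ(p): distinct vertices c 0,…,c k with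
-- arcs c i → c (i+1) and c k → c 0
Cycle : ∀ {n h} → ℕ → Profile n h → ℕ → Set
Cycle {n} μ p zero = ⊥
Cycle {n} μ p (suc k) =
  Σ (Fin (suc k) → Fin n) λ c →
    Injective _≡_ _≡_ c ×
    (∀ (i : Fin k) → Arc μ p (c (inject₁ i)) (c (suc i))) ×
    Arc μ p (c (fromℕ k)) (c zero)

Acyclic : ∀ {n h} → ℕ → Profile n h → Set
Acyclic μ p = ∀ l → 2 ≤ l → ¬ Cycle μ p l

SingletonD : ∀ {n h} → ℕ → Profile n h → Set
SingletonD μ p = ∃[ x ] (D μ p x × ∀ y → D μ p y → y ≡ x)

-- If x lies in both D_μ(p)(p) and D_μ(pʳ)(pʳ) with μ(pʳ) ≤ μ(p), then no y beats x
-- by a μ(p)-majority, and since reversing the profile swaps who beats whom, x beats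
-- no y by a μ(pʳ)-majority either: x is isolated in Γ_μ(p)(p), which is impossible
-- when the graph is connected. If moreover D_μ(p)(p) = {x}, every other vertex y is
-- outside D_μ(p)(p), so some z beats it by a μ(p)-majority, and z ≠ x because x is
-- isolated. Following such predecessors forever inside the finite set N ∖ {x} must
-- revisit a vertex, and a shortest revisit is a cycle of length at least 2 (there
-- are no loops), contradicting acyclicity.
module Submission where

open import Defs
open import Data.Nat using (ℕ; zero; suc; _+_; _∸_; _≤_; _<_; _<?_; z≤n; s≤s)
open import Data.Nat.Properties
  using (<⇒≱; ≮⇒≥; <-≤-trans; ≤-<-trans; <-irrefl; n<1+n; +-suc; +-identityʳ;
         m+[n∸m]≡n; m∸n≤m; ∸-monoˡ-<; ∸-monoʳ-<)
open import Data.Nat.Induction using (<-rec)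
open import Data.Fin as Fin using (Fin; zero; suc; toℕ; inject₁; fromℕ; opposite; punchIn)
open import Data.Fin.Properties
  using (toℕ<n; toℕ-inject₁; toℕ-fromℕ; opposite-prop; opposite-involutive; punchInᵢ≢i;
         <-cmp; any?; ¬∀⟶∃¬; pigeonhole)
open import Data.List using (length; filter; allFin)
open import Data.List.Properties using (filter-none)
import Data.List.Relation.Unary.All as All
open import Data.List.Relation.Binary.Sublist.Heterogeneous.Properties
  using (length-mono-≤; ⊆-filter-Sublist)
open import Data.List.Relation.Binary.Sublist.Propositional using (⊆-refl)
open import Data.Product using (Σ; ∃; _×_; _,_; proj₁; proj₂)
open import Data.Sum using (_⊎_; inj₁; inj₂)
open import Data.Empty using (⊥-elim)
open import Function using (_∘_; flip)
open import Function.Definitions using (Injective)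
open import Relation.Binary using (Rel; tri<; tri≈; tri>)
open import Relation.Binary.Construct.Closure.ReflexiveTransitive using (Star; ε; _◅_)
open import Relation.Binary.PropositionalEquality
open import Relation.Nullary using (¬_; yes; no)
open import Relation.Nullary.Decidable using (_×-dec_)
open import Relation.Unary using (Pred)
open import Level using (0ℓ)

opposite-reverses-< : ∀ {n} {i j : Fin n} → i Fin.< j → opposite j Fin.< opposite i
opposite-reverses-< {n} {i} {j} i<j =
  subst₂ _<_ (sym (opposite-prop j)) (sym (opposite-prop i))
    (∸-monoʳ-< (s≤s i<j) (toℕ<n j))

opposite-inject₁ : ∀ {k} (i : Fin k) → opposite (inject₁ i) ≡ suc (opposite i)
opposite-inject₁ zero    = refl
opposite-inject₁ (suc i) = cong inject₁ (opposite-inject₁ i)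

opposite-fromℕ : ∀ k → opposite (fromℕ k) ≡ zero
opposite-fromℕ zero    = refl
opposite-fromℕ (suc k) = cong inject₁ (opposite-fromℕ k)

∃-≢ : ∀ {n} → 2 ≤ n → (x : Fin n) → ∃ λ y → y ≢ x
∃-≢ (s≤s (s≤s _)) x = punchIn x zero , punchInᵢ≢i x zero

Admissible⇒positive : ∀ {h μ} → Admissible h μ → 1 ≤ μ
Admissible⇒positive {μ = suc _} _ = s≤s z≤n

module _ {n : ℕ} (R : Rel (Fin n) 0ℓ) where

  -- Mirrors Defs.Cycle, so that IsCycle (Arc μ p) k is definitionally Cycle μ p (suc k).
  IsCycle : ℕ → Set
  IsCycle k = Σ (Fin (suc k) → Fin n) λ c →
    Injective _≡_ _≡_ c ×
    (∀ (i : Fin k) → R (c (inject₁ i)) (c (suc i))) ×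
    R (c (fromℕ k)) (c zero)

  IsWalk : (ℕ → Fin n) → Set
  IsWalk w = ∀ j → R (w j) (w (suc j))

  shift : ℕ → (ℕ → Fin n) → ℕ → Fin n
  shift a w j = w (a + j)

  IsWalk-shift : ∀ {w} a → IsWalk w → IsWalk (shift a w)
  IsWalk-shift {w} a walk j = subst (R (w (a + j)) ∘ w) (sym (+-suc a j)) (walk (a + j))

  repeat-shift : ∀ (w : ℕ → Fin n) {i j} → i < j → w i ≡ w j →
                 shift i w (suc (j ∸ suc i)) ≡ shift i w 0
  repeat-shift w {i} {j} i<j wi≡wj = begin
    w (i + suc (j ∸ suc i)) ≡⟨ cong w (trans (+-suc i _) (m+[n∸m]≡n i<j)) ⟩
    w j                     ≡⟨ sym wi≡wj ⟩
    w i                     ≡⟨ cong w (sym (+-identityʳ i)) ⟩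
    w (i + 0)               ∎
    where open ≡-Reasoning

  injective-closed-walk⇒IsCycle : ∀ {w} k → IsWalk w → w (suc k) ≡ w 0 →
    Injective _≡_ _≡_ (λ (i : Fin (suc k)) → w (toℕ i)) → IsCycle k
  injective-closed-walk⇒IsCycle {w} k walk closed inj = w ∘ toℕ , inj , arcs , closing
    where
    arcs : ∀ (i : Fin k) → R (w (toℕ (inject₁ i))) (w (suc (toℕ i)))
    arcs i = subst (λ t → R (w t) (w (suc (toℕ i)))) (sym (toℕ-inject₁ i)) (walk (toℕ i))
    closing : R (w (toℕ (fromℕ k))) (w 0)
    closing = subst₂ (λ s t → R (w s) t) (sym (toℕ-fromℕ k)) closed (walk k)

  -- A closed walk of length suc k either has no repeated vertex before its end,
  -- or contains a strictly shorter closed walk.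
  closed-walk⇒IsCycle : ∀ k {w} → IsWalk w → w (suc k) ≡ w 0 → ∃ IsCycle
  closed-walk⇒IsCycle = <-rec _ shorten
    where
    shorten : ∀ k → (∀ {d} → d < k → ∀ {w} → IsWalk w → w (suc d) ≡ w 0 → ∃ IsCycle) →
              ∀ {w} → IsWalk w → w (suc k) ≡ w 0 → ∃ IsCycle
    shorten k shorter {w} walk closed
      with any? (λ (i : Fin (suc k)) → any? λ j → (i Fin.<? j) ×-dec (w (toℕ i) Fin.≟ w (toℕ j)))
    ... | yes (i , j , i<j , wi≡wj) =
      shorter (<-≤-trans (∸-monoˡ-< (toℕ<n j) i<j) (m∸n≤m k (toℕ i)))
              (IsWalk-shift (toℕ i) walk) (repeat-shift w i<j wi≡wj)
    ... | no no-repeat = k , injective-closed-walk⇒IsCycle k walk closed inj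
      where
      inj : Injective _≡_ _≡_ (λ (i : Fin (suc k)) → w (toℕ i))
      inj {i} {j} wi≡wj with <-cmp i j
      ... | tri< i<j _ _ = ⊥-elim (no-repeat (i , j , i<j , wi≡wj))
      ... | tri≈ _ i≡j _ = i≡j
      ... | tri> _ _ j<i = ⊥-elim (no-repeat (j , i , j<i , sym wi≡wj))

  walk⇒IsCycle : ∀ {w} → IsWalk w → ∃ IsCycle
  walk⇒IsCycle {w} walk with pigeonhole (n<1+n n) (w ∘ toℕ)
  ... | i , j , i<j , wi≡wj =
    closed-walk⇒IsCycle _ (IsWalk-shift (toℕ i) walk) (repeat-shift w i<j wi≡wj)

  irreflexive⇒∃IsCycle-suc : (∀ x → ¬ R x x) → ∃ IsCycle → ∃ (IsCycle ∘ suc)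
  irreflexive⇒∃IsCycle-suc irrefl (zero  , c , _ , _ , loop) = ⊥-elim (irrefl (c zero) loop)
  irreflexive⇒∃IsCycle-suc irrefl (suc k , cycle)               = k , cycle

IsCycle-flip : ∀ {n} {R : Rel (Fin n) 0ℓ} {k} → IsCycle (flip R) k → IsCycle R k
IsCycle-flip {R = R} {k} (c , inj , arcs , closing) = c ∘ opposite , inj′ , arcs′ , closing′
  where
  inj′ : Injective _≡_ _≡_ (c ∘ opposite)
  inj′ {i} {j} e = begin
    i                       ≡⟨ opposite-involutive i ⟨
    opposite (opposite i)   ≡⟨ cong opposite (inj e) ⟩
    opposite (opposite j)   ≡⟨ opposite-involutive j ⟩
    j                       ∎
    where open ≡-Reasoning
  arcs′ : ∀ (i : Fin k) → R (c (opposite (inject₁ i))) (c (inject₁ (opposite i)))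
  arcs′ i = subst (λ t → R (c t) (c (inject₁ (opposite i)))) (sym (opposite-inject₁ i))
                  (arcs (opposite i))
  closing′ : R (c (opposite (fromℕ k))) (c (fromℕ k))
  closing′ = subst (λ t → R (c t) (c (fromℕ k))) (sym (opposite-fromℕ k)) closing

predecessor-closed⇒IsCycle : ∀ {n} {R : Rel (Fin n) 0ℓ} (P : Pred (Fin n) 0ℓ) →
  (∀ y → P y → ∃ λ z → P z × R z y) → ∀ {y} → P y → ∃ (IsCycle R)
predecessor-closed⇒IsCycle {n} {R} P pred {y} Py =
  let k , cycle = walk⇒IsCycle (flip R) {proj₁ ∘ walk} backwards in k , IsCycle-flip {R = R} cycle
  where
  walk : ℕ → Σ (Fin n) P
  walk zero    = y , Py
  walk (suc j) = let z , Pz , _ = pred (proj₁ (walk j)) (proj₂ (walk j)) in z , Pz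
  backwards : IsWalk (flip R) (proj₁ ∘ walk)
  backwards j = proj₂ (proj₂ (pred (proj₁ (walk j)) (proj₂ (walk j))))

module _ {n h : ℕ} (p : Profile n h) where

  beats-irrefl : ∀ x → beats p x x ≡ 0
  beats-irrefl x =
    cong length (filter-none _ (All.universal (λ i → <-irrefl refl) (allFin h)))

  beats≤beats-rev : ∀ x y → beats p x y ≤ beats (rev p) y x
  beats≤beats-rev x y =
    length-mono-≤ (⊆-filter-Sublist (λ i → rank (p i) x Fin.<? rank (p i) y)
                                   (λ i → rank (rev p i) y Fin.<? rank (rev p i) x)
                                   (λ { refl → opposite-reverses-< }) (⊆-refl {x = allFin h}))

  module _ {μ : ℕ} where

    Arc-irrefl : 1 ≤ μ → ∀ x → ¬ Arc μ p x x
    Arc-irrefl 1≤μ x arc = <⇒≱ 1≤μ (subst (μ ≤_) (beats-irrefl x) arc)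

    ¬D⇒∃-Arc : ∀ {y} → ¬ D μ p y → ∃ λ z → Arc μ p z y
    ¬D⇒∃-Arc {y} ¬Dy =
      let z , ¬z<μ = ¬∀⟶∃¬ n _ (λ z → beats p z y <? μ) ¬Dy in z , ≮⇒≥ ¬z<μ

    Isolated-unreachable : ∀ {x y} → Isolated μ p x →
      Star (λ a b → Arc μ p a b ⊎ Arc μ p b a) x y → y ≡ x
    Isolated-unreachable iso ε              = refl
    Isolated-unreachable iso (inj₁ arc ◅ _) = ⊥-elim (proj₁ (iso _) arc)
    Isolated-unreachable iso (inj₂ arc ◅ _) = ⊥-elim (proj₂ (iso _) arc)

    Connected⇒¬Isolated : 2 ≤ n → Connected μ p → ∀ x → ¬ Isolated μ p x
    Connected⇒¬Isolated 2≤n conn x iso =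
      let y , y≢x = ∃-≢ 2≤n x in y≢x (Isolated-unreachable iso (conn x y))

  D∩Drev⇒Isolated : ∀ {μ μ′} → μ′ ≤ μ → ∀ x → D μ p x → D μ′ (rev p) x → Isolated μ p x
  D∩Drev⇒Isolated μ′≤μ x Dx Drevx y =
    <⇒≱ (<-≤-trans (≤-<-trans (beats≤beats-rev x y) (Drevx y)) μ′≤μ) , <⇒≱ (Dx y)

  SingletonD-Isolated⇒¬Acyclic : ∀ {μ} → 1 ≤ μ → 2 ≤ n → SingletonD μ p →
    ∀ x → D μ p x → Isolated μ p x → ¬ Acyclic μ p
  SingletonD-Isolated⇒¬Acyclic {μ} 1≤μ 2≤n (_ , _ , unique) x Dx iso acyclic =
    let k , cycle = irreflexive⇒∃IsCycle-suc (Arc μ p) (Arc-irrefl 1≤μ)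
                      (predecessor-closed⇒IsCycle (_≢ x) pred (proj₂ (∃-≢ 2≤n x)))
    in acyclic (suc (suc k)) (s≤s (s≤s z≤n)) cycle
    where
    pred : ∀ y → y ≢ x → ∃ λ z → z ≢ x × Arc μ p z y
    pred y y≢x =
      let z , arc = ¬D⇒∃-Arc (λ Dy → y≢x (trans (unique y Dy) (sym (unique x Dx))))
      in z , (λ z≡x → proj₁ (iso y) (subst (λ t → Arc μ p t y) z≡x arc)) , arc

lemma16 : ∀ (n h : ℕ) → 2 ≤ n → 2 ≤ h → (p : Profile n h) →
            (m m′ : ℕ) → IsMu p m → IsMu (rev p) m′ → m′ ≤ m →
            ((∀ x → D m p x → D m′ (rev p) x → Isolated m p x) ×
             (Connected m p → ∀ x → ¬ (D m p x × D m′ (rev p) x)))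
            × (SingletonD m p → Acyclic m p → ∀ x → ¬ (D m p x × D m′ (rev p) x))
lemma16 n h 2≤n _ p m m′ (admissible , _) _ m′≤m = (isolated , connected) , singleton
  where
  isolated : ∀ x → D m p x → D m′ (rev p) x → Isolated m p x
  isolated = D∩Drev⇒Isolated p m′≤m
  connected : Connected m p → ∀ x → ¬ (D m p x × D m′ (rev p) x)
  connected conn x (Dx , Drevx) = Connected⇒¬Isolated p 2≤n conn x (isolated x Dx Drevx)
  singleton : SingletonD m p → Acyclic m p → ∀ x → ¬ (D m p x × D m′ (rev p) x)
  singleton single acyclic x (Dx , Drevx) =
    SingletonD-Isolated⇒¬Acyclic p (Admissible⇒positive admissible) 2≤n single x Dx
      (isolated x Dx Drevx) acyclic
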